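{- Let $\tau,\epsilon\in(0,1)$ be constants and let $Q$ be the output of the sampling procedure below with a parameter $t\ge\frac{1}{\tau\epsilon}$. Then every edge $e\in E$ with $x_e\ge\tau$ satisfies $\Pr[e\in Q]\ge 1-\epsilon$.
   Context: $G=(V,E)$ is a finite graph with nonnegative edge weights and probabilities $p_e\in(0,1]$; the realization $\mathcal{G}$ contains each edge $e$ independently with probability $p_e$. $\mu(\cdot)$ is a fixed deterministic algorithm returning a maximum-weight matching of a given graph, $\mathrm{OPT}=\mu(\mathcal{G})$ and $x_e=\Pr[e\in\mathrm{OPT}]$. Sampling procedure with positive integer parameter $t$: for $i=1,\dots,t$, draw independently a random subgraph $G_i$ of $G$ containing each edge $e$ independently with probability $p_e$, let $M_i=\mu(G_i)$; output $Q=\bigcup_{i=1}^t M_i$.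
   Formalization: The edge weights, the probabilities $p_e$ and the constants $\tau,\epsilon$ take rational values. -}

module Defs where

open import Data.Nat using (ℕ; zero; suc)
open import Data.Fin using (Fin)
open import Data.Bool using (Bool; true; false; if_then_else_)
open import Data.Vec using (Vec; []; _∷_; lookup; tabulate)
open import Data.List using (List; []; _∷_; map; concatMap; foldr)
open import Data.Product using (_×_; _,_; proj₁; proj₂)
open import Data.Integer using (+_)
open import Data.Rational using (ℚ; 0ℚ; 1ℚ; _+_; _*_; _-_; _≤_; _<_; _/_)
open import Relation.Binary.PropositionalEquality using (_≡_; _≢_)

EdgeMap : ℕ → ℕ → Set
EdgeMap n m = Fin m → Fin n × Fin n

Loopless : ∀ {n m} → EdgeMap n m → Set
Loopless ends = ∀ i → proj₁ (ends i) ≢ proj₂ (ends i)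

EdgeSet : ℕ → Set
EdgeSet m = Vec Bool m

_∈ₑ_ : ∀ {m} → Fin m → EdgeSet m → Set
i ∈ₑ S = lookup S i ≡ true

_⊆ₑ_ : ∀ {m} → EdgeSet m → EdgeSet m → Set
A ⊆ₑ B = ∀ i → i ∈ₑ A → i ∈ₑ B

Disjoint : ∀ {n} → Fin n × Fin n → Fin n × Fin n → Set
Disjoint (a , b) (c , d) = (a ≢ c) × (a ≢ d) × (b ≢ c) × (b ≢ d)

IsMatching : ∀ {n m} → EdgeMap n m → EdgeSet m → Set
IsMatching ends M = ∀ i j → i ≢ j → i ∈ₑ M → j ∈ₑ M → Disjoint (ends i) (ends j)

sumℚ : List ℚ → ℚ
sumℚ = foldr _+_ 0ℚ

prodℚ : List ℚ → ℚ
prodℚ = foldr _*_ 1ℚ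

allFins : (m : ℕ) → List (Fin m)
allFins m = Data.List.tabulate (λ i → i)
  where import Data.List

weight : ∀ {m} → (Fin m → ℚ) → EdgeSet m → ℚ
weight {m} w S = sumℚ (map (λ i → if lookup S i then w i else 0ℚ) (allFins m))

IsMaxWeightMatchingAlg : ∀ {n m} → EdgeMap n m → (Fin m → ℚ) → (EdgeSet m → EdgeSet m) → Set
IsMaxWeightMatchingAlg ends w μ =
  ∀ S → (μ S ⊆ₑ S) × IsMatching ends (μ S) ×
        (∀ M → M ⊆ₑ S → IsMatching ends M → weight w M ≤ weight w (μ S))

allEdgeSets : (m : ℕ) → List (EdgeSet m)
allEdgeSets zero = [] ∷ []
allEdgeSets (suc m) = concatMap (λ S → (true ∷ S) ∷ (false ∷ S) ∷ []) (allEdgeSets m)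

PrSub : ∀ {m} → (Fin m → ℚ) → EdgeSet m → ℚ
PrSub {m} p S = prodℚ (map (λ i → if lookup S i then p i else 1ℚ - p i) (allFins m))

ind : Bool → ℚ
ind b = if b then 1ℚ else 0ℚ

xₑ : ∀ {m} → (Fin m → ℚ) → (EdgeSet m → EdgeSet m) → Fin m → ℚ
xₑ {m} p μ e = sumℚ (map (λ S → PrSub p S * ind (lookup (μ S) e)) (allEdgeSets m))

-- all t-tuples of edge sets (the t independent samples G₁,…,G_t)
allTuples : ∀ m → (t : ℕ) → List (Vec (EdgeSet m) t)
allTuples m zero = [] ∷ []
allTuples m (suc t) = concatMap (λ G → map (G ∷_) (allTuples m t)) (allEdgeSets m)

PrTuple : ∀ {m t} → (Fin m → ℚ) → Vec (EdgeSet m) t → ℚ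
PrTuple p [] = 1ℚ
PrTuple p (G ∷ Gs) = PrSub p G * PrTuple p Gs

-- e ∈ Q = ⋃ᵢ μ(Gᵢ)  (as a Bool)
inQ : ∀ {m t} → (EdgeSet m → EdgeSet m) → Vec (EdgeSet m) t → Fin m → Bool
inQ μ [] e = false
inQ μ (G ∷ Gs) e = lookup (μ G) e Data.Bool.∨ inQ μ Gs e
  where import Data.Bool

PrInQ : ∀ {m} → (Fin m → ℚ) → (EdgeSet m → EdgeSet m) → (t : ℕ) → Fin m → ℚ
PrInQ {m} p μ t e = sumℚ (map (λ Gs → PrTuple p Gs * ind (inQ μ Gs e)) (allTuples m t))

toℚ : ℕ → ℚ
toℚ k = + k / 1

{-# OPTIONS --safe #-}
-- Each of the t independent samples misses e with probability 1 - xₑ, so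
-- Pr[e ∉ Q] = (1 - xₑ)^t.  Bernoulli's inequality (1 - x)^t (1 + t x) ≤ 1 gives
-- (1 - xₑ)^t · t xₑ ≤ 1, and since t xₑ ε ≥ t τ ε ≥ 1 this forces (1 - xₑ)^t ≤ ε.
-- Nothing about μ is used beyond its being a function of the sample.
module Submission where

open import Defs
open import Data.Nat using (ℕ)
open import Data.Fin using (Fin)
open import Data.Product using (_×_)
open import Data.Rational using (ℚ; 0ℚ; 1ℚ; _*_; _-_; _≤_; _<_)

open import Algebra.Definitions.RawSemiring Data.Rational.+-*-rawSemiring using (_^_)
open import Data.Bool using (true; false; if_then_else_; _∨_)
import Data.Fin as Fin
import Data.Integer as ℤ
import Data.Integer.Properties as ℤ
open import Data.List using (List; []; _∷_; map; concatMap; _++_; tabulate)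
import Data.List.Properties as List
open import Data.Nat using (zero; suc)
import Data.Nat.Coprimality as Coprimality
import Data.Nat.Properties as ℕ
open import Data.Product using (_,_; proj₁; proj₂)
open import Data.Rational using (_+_; nonNegative)
open import Data.Rational.Properties
open import Data.Vec using (Vec; []; _∷_; lookup)
open import Function using (_∘_)
open import Level using (0ℓ)
open import Relation.Binary.PropositionalEquality
open import Relation.Nullary.Decidable using (dec⇒maybe)
open import Tactic.RingSolver using (solve-∀)
import Tactic.RingSolver.Core.AlmostCommutativeRing as ACR

private
  variable
    A B : Set

ℚ-ring : ACR.AlmostCommutativeRing 0ℓ 0ℓ
ℚ-ring = ACR.fromCommutativeRing +-*-commutativeRing (λ x → dec⇒maybe (0ℚ ≟ x))

*-monoˡ-≤-0≤ : ∀ {r p q} → 0ℚ ≤ r → p ≤ q → r * p ≤ r * q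
*-monoˡ-≤-0≤ {r} 0≤r = *-monoˡ-≤-nonNeg r {{nonNegative 0≤r}}

*-monoʳ-≤-0≤ : ∀ {r p q} → 0ℚ ≤ r → p ≤ q → p * r ≤ q * r
*-monoʳ-≤-0≤ {r} 0≤r = *-monoʳ-≤-nonNeg r {{nonNegative 0≤r}}

0≤*0≤ : ∀ {p q} → 0ℚ ≤ p → 0ℚ ≤ q → 0ℚ ≤ p * q
0≤*0≤ {p} {q} 0≤p 0≤q =
  nonNegative⁻¹ (p * q) {{nonNeg*nonNeg⇒nonNeg p {{nonNegative 0≤p}} q {{nonNegative 0≤q}}}}

0≤1-p : ∀ {p} → p ≤ 1ℚ → 0ℚ ≤ 1ℚ - p
0≤1-p {p} p≤1 = ≤-trans (≤-reflexive (sym (+-inverseʳ 1ℚ))) (+-monoʳ-≤ 1ℚ (neg-antimono-≤ p≤1))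

p≤q+p : ∀ {p q} → 0ℚ ≤ q → p ≤ q + p
p≤q+p {p} 0≤q = ≤-trans (≤-reflexive (sym (+-identityˡ p))) (+-monoˡ-≤ p 0≤q)

^-nonNeg : ∀ {p} → 0ℚ ≤ p → ∀ n → 0ℚ ≤ p ^ n
^-nonNeg 0≤p zero    = nonNegative⁻¹ 1ℚ
^-nonNeg 0≤p (suc n) = 0≤*0≤ 0≤p (^-nonNeg 0≤p n)

toℚ-nonNeg : ∀ t → 0ℚ ≤ toℚ t
toℚ-nonNeg t = nonNegative⁻¹ (toℚ t) {{normalize-nonNeg t 1}}

-- `+ t / 1` is normalised through a gcd, so it only computes after `normalize-coprime`.
toℚ-suc : ∀ t → toℚ (suc t) ≡ toℚ t + 1ℚ
toℚ-suc t rewrite normalize-coprime {t} {0} (Coprimality.sym (Coprimality.1-coprimeTo t)) =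
  sym (/-cong numerator refl)
  where
  numerator : ℤ.+ t ℤ.* ℤ.+ 1 ℤ.+ ℤ.+ 1 ℤ.* ℤ.+ 1 ≡ ℤ.+ (suc t)
  numerator = trans (cong₂ ℤ._+_ (ℤ.*-identityʳ (ℤ.+ t)) refl) (cong ℤ.+_ (ℕ.+-comm t 1))

bernoulli : ∀ {x} → 0ℚ ≤ x → x ≤ 1ℚ → ∀ t → (1ℚ - x) ^ t * (1ℚ + toℚ t * x) ≤ 1ℚ
bernoulli {x} 0≤x x≤1 zero =
  ≤-reflexive (trans (*-identityˡ _) (trans (cong (1ℚ +_) (*-zeroˡ x)) (+-identityʳ 1ℚ)))
bernoulli {x} 0≤x x≤1 (suc t) = begin
  (1ℚ - x) ^ suc t * (1ℚ + toℚ (suc t) * x)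
    ≡⟨ cong (λ c → (1ℚ - x) ^ suc t * (1ℚ + c * x)) (toℚ-suc t) ⟩
  (1ℚ - x) * y * (1ℚ + (c + 1ℚ) * x)
    ≡⟨ regroup (1ℚ - x) y c x ⟩
  y * ((1ℚ - x) * (1ℚ + (c + 1ℚ) * x))
    ≤⟨ *-monoˡ-≤-0≤ (^-nonNeg (0≤1-p x≤1) t) step ⟩
  y * (1ℚ + c * x)
    ≤⟨ bernoulli 0≤x x≤1 t ⟩
  1ℚ
    ∎
  where
  open ≤-Reasoning
  y = (1ℚ - x) ^ t
  c = toℚ t
  regroup : ∀ a y c x → a * y * (1ℚ + (c + 1ℚ) * x) ≡ y * (a * (1ℚ + (c + 1ℚ) * x))
  regroup = solve-∀ ℚ-ring
  expand : ∀ x c → x * x * (c + 1ℚ) + (1ℚ - x) * (1ℚ + (c + 1ℚ) * x) ≡ 1ℚ + c * x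
  expand = solve-∀ ℚ-ring
  step : (1ℚ - x) * (1ℚ + (c + 1ℚ) * x) ≤ 1ℚ + c * x
  step = ≤-trans (p≤q+p (0≤*0≤ (0≤*0≤ 0≤x 0≤x) (+-mono-≤ (toℚ-nonNeg t) (nonNegative⁻¹ 1ℚ))))
                 (≤-reflexive (expand x c))

[1-x]^t≤ε : ∀ {x ε} → 0ℚ ≤ x → x ≤ 1ℚ → 0ℚ ≤ ε → ∀ t → 1ℚ ≤ toℚ t * x * ε → (1ℚ - x) ^ t ≤ ε
[1-x]^t≤ε {x} {ε} 0≤x x≤1 0≤ε t 1≤txε = begin
  y                    ≡⟨ *-identityʳ y ⟨
  y * 1ℚ               ≤⟨ *-monoˡ-≤-0≤ 0≤y 1≤txε ⟩
  y * (toℚ t * x * ε)  ≡⟨ *-assoc y _ ε ⟨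
  y * (toℚ t * x) * ε  ≤⟨ *-monoʳ-≤-0≤ 0≤ε y·tx≤1 ⟩
  1ℚ * ε               ≡⟨ *-identityˡ ε ⟩
  ε                    ∎
  where
  open ≤-Reasoning
  y = (1ℚ - x) ^ t
  0≤y : 0ℚ ≤ y
  0≤y = ^-nonNeg (0≤1-p x≤1) t
  y·tx≤1 : y * (toℚ t * x) ≤ 1ℚ
  y·tx≤1 = ≤-trans (*-monoˡ-≤-0≤ 0≤y (p≤q+p (nonNegative⁻¹ 1ℚ))) (bernoulli 0≤x x≤1 t)

∑ : List A → (A → ℚ) → ℚ
∑ xs f = sumℚ (map f xs)

syntax ∑ xs (λ a → f) = ∑[ a ∈ xs ] f

∑-cong : ∀ {f g : A → ℚ} xs → (∀ a → f a ≡ g a) → ∑ xs f ≡ ∑ xs g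
∑-cong xs f≗g = cong sumℚ (List.map-cong f≗g xs)

∑-++ : ∀ xs ys (f : A → ℚ) → ∑ (xs ++ ys) f ≡ ∑ xs f + ∑ ys f
∑-++ []       ys f = sym (+-identityˡ _)
∑-++ (x ∷ xs) ys f = trans (cong (f x +_) (∑-++ xs ys f)) (sym (+-assoc (f x) _ _))

∑-concatMap : ∀ (g : A → List B) xs f → ∑ (concatMap g xs) f ≡ ∑[ a ∈ xs ] ∑ (g a) f
∑-concatMap g []       f = refl
∑-concatMap g (x ∷ xs) f =
  trans (∑-++ (g x) (concatMap g xs) f) (cong (∑ (g x) f +_) (∑-concatMap g xs f))

∑-+ : ∀ xs (f g : A → ℚ) → ∑[ a ∈ xs ] (f a + g a) ≡ ∑ xs f + ∑ xs g
∑-+ []       f g = sym (+-identityˡ 0ℚ)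
∑-+ (x ∷ xs) f g = trans (cong (f x + g x +_) (∑-+ xs f g)) (interchange (f x) (g x) _ _)
  where
  interchange : ∀ a b c d → a + b + (c + d) ≡ a + c + (b + d)
  interchange = solve-∀ ℚ-ring

∑-*ˡ : ∀ xs c (f : A → ℚ) → ∑[ a ∈ xs ] (c * f a) ≡ c * ∑ xs f
∑-*ˡ []       c f = sym (*-zeroʳ c)
∑-*ˡ (x ∷ xs) c f = trans (cong (c * f x +_) (∑-*ˡ xs c f)) (sym (*-distribˡ-+ c (f x) _))

∑-mono-≤ : ∀ {f g : A → ℚ} xs → (∀ a → f a ≤ g a) → ∑ xs f ≤ ∑ xs g
∑-mono-≤ []       f≤g = ≤-refl
∑-mono-≤ (x ∷ xs) f≤g = +-mono-≤ (f≤g x) (∑-mono-≤ xs f≤g)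

𝔼 : List A → (A → ℚ) → (A → ℚ) → ℚ
𝔼 xs w f = ∑[ a ∈ xs ] (w a * f a)

module _ (xs : List A) (w : A → ℚ) where

  𝔼-cong : ∀ {f g} → (∀ a → f a ≡ g a) → 𝔼 xs w f ≡ 𝔼 xs w g
  𝔼-cong f≗g = ∑-cong xs (λ a → cong (w a *_) (f≗g a))

  𝔼-const : ∑ xs w ≡ 1ℚ → ∀ c → 𝔼 xs w (λ _ → c) ≡ c
  𝔼-const ∑w≡1 c = begin
    ∑[ a ∈ xs ] (w a * c) ≡⟨ ∑-cong xs (λ a → *-comm (w a) c) ⟩
    ∑[ a ∈ xs ] (c * w a) ≡⟨ ∑-*ˡ xs c w ⟩
    c * ∑ xs w            ≡⟨ cong (c *_) ∑w≡1 ⟩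
    c * 1ℚ                ≡⟨ *-identityʳ c ⟩
    c                     ∎
    where open ≡-Reasoning

  𝔼-affine : ∑ xs w ≡ 1ℚ → ∀ a b f → 𝔼 xs w (λ y → a + b * f y) ≡ a + b * 𝔼 xs w f
  𝔼-affine ∑w≡1 a b f = begin
    ∑[ y ∈ xs ] (w y * (a + b * f y))
      ≡⟨ ∑-cong xs (λ y → distribute (w y) a b (f y)) ⟩
    ∑[ y ∈ xs ] (w y * a + b * (w y * f y))
      ≡⟨ ∑-+ xs (λ y → w y * a) (λ y → b * (w y * f y)) ⟩
    𝔼 xs w (λ _ → a) + ∑[ y ∈ xs ] (b * (w y * f y))
      ≡⟨ cong₂ _+_ (𝔼-const ∑w≡1 a) (∑-*ˡ xs b (λ y → w y * f y)) ⟩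
    a + b * 𝔼 xs w f
      ∎
    where
    open ≡-Reasoning
    distribute : ∀ w a b f → w * (a + b * f) ≡ w * a + b * (w * f)
    distribute = solve-∀ ℚ-ring

  𝔼-mono-≤ : (∀ a → 0ℚ ≤ w a) → ∀ {f g} → (∀ a → f a ≤ g a) → 𝔼 xs w f ≤ 𝔼 xs w g
  𝔼-mono-≤ 0≤w f≤g = ∑-mono-≤ xs (λ a → *-monoˡ-≤-0≤ (0≤w a) (f≤g a))

  𝔼-∈[0,1] : (∀ a → 0ℚ ≤ w a) → ∑ xs w ≡ 1ℚ → ∀ {f} → (∀ a → 0ℚ ≤ f a) → (∀ a → f a ≤ 1ℚ) →
             (0ℚ ≤ 𝔼 xs w f) × (𝔼 xs w f ≤ 1ℚ)
  𝔼-∈[0,1] 0≤w ∑w≡1 0≤f f≤1 =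
    ≤-trans (≤-reflexive (sym (𝔼-const ∑w≡1 0ℚ))) (𝔼-mono-≤ 0≤w 0≤f) ,
    ≤-trans (𝔼-mono-≤ 0≤w f≤1) (≤-reflexive (𝔼-const ∑w≡1 1ℚ))

0≤ind : ∀ b → 0ℚ ≤ ind b
0≤ind true  = nonNegative⁻¹ 1ℚ
0≤ind false = ≤-refl

ind≤1 : ∀ b → ind b ≤ 1ℚ
ind≤1 true  = ≤-refl
ind≤1 false = nonNegative⁻¹ 1ℚ

PrSub-nonNeg : ∀ {m} (p : Fin m → ℚ) → (∀ i → (0ℚ ≤ p i) × (p i ≤ 1ℚ)) → ∀ S → 0ℚ ≤ PrSub p S
PrSub-nonNeg {m} p 0≤p≤1 S = prodℚ-nonNeg (allFins m)
  where
  factor : Fin m → ℚ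
  factor i = if lookup S i then p i else 1ℚ - p i
  factor-nonNeg : ∀ i → 0ℚ ≤ factor i
  factor-nonNeg i with lookup S i
  ... | true  = proj₁ (0≤p≤1 i)
  ... | false = 0≤1-p (proj₂ (0≤p≤1 i))
  prodℚ-nonNeg : ∀ is → 0ℚ ≤ prodℚ (map factor is)
  prodℚ-nonNeg []       = nonNegative⁻¹ 1ℚ
  prodℚ-nonNeg (i ∷ is) = 0≤*0≤ (factor-nonNeg i) (prodℚ-nonNeg is)

PrSub-∷ : ∀ {m} (p : Fin (suc m) → ℚ) b S →
          PrSub p (b ∷ S) ≡ (if b then p Fin.zero else 1ℚ - p Fin.zero) * PrSub (p ∘ Fin.suc) S
PrSub-∷ {m} p b S = cong (λ fs → factor Fin.zero * prodℚ fs) (begin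
  map factor (tabulate Fin.suc)       ≡⟨ List.map-tabulate Fin.suc factor ⟩
  tabulate (factor ∘ Fin.suc)         ≡⟨ List.map-tabulate (λ i → i) (factor ∘ Fin.suc) ⟨
  map (factor ∘ Fin.suc) (allFins m)  ∎)
  where
  open ≡-Reasoning
  factor : Fin (suc m) → ℚ
  factor i = if lookup (b ∷ S) i then p i else 1ℚ - p i

∑-PrSub : ∀ m (p : Fin m → ℚ) → ∑ (allEdgeSets m) (PrSub p) ≡ 1ℚ
∑-PrSub zero    p = refl
∑-PrSub (suc m) p = begin
  ∑ (allEdgeSets (suc m)) (PrSub p)
    ≡⟨ ∑-concatMap _ (allEdgeSets m) (PrSub p) ⟩
  ∑[ S ∈ allEdgeSets m ] (PrSub p (true ∷ S) + (PrSub p (false ∷ S) + 0ℚ))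
    ≡⟨ ∑-cong (allEdgeSets m) (λ S → cong₂ (λ u v → u + (v + 0ℚ)) (PrSub-∷ p true S) (PrSub-∷ p false S)) ⟩
  ∑[ S ∈ allEdgeSets m ] (p₀ * PrSub p′ S + ((1ℚ - p₀) * PrSub p′ S + 0ℚ))
    ≡⟨ ∑-cong (allEdgeSets m) (λ S → split p₀ (PrSub p′ S)) ⟩
  ∑ (allEdgeSets m) (PrSub p′)
    ≡⟨ ∑-PrSub m p′ ⟩
  1ℚ
    ∎
  where
  open ≡-Reasoning
  p₀ = p Fin.zero
  p′ = p ∘ Fin.suc
  split : ∀ a y → a * y + ((1ℚ - a) * y + 0ℚ) ≡ y
  split = solve-∀ ℚ-ring

∑-allTuples-suc : ∀ m t (g : Vec (EdgeSet m) (suc t) → ℚ) →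
                  ∑ (allTuples m (suc t)) g ≡ ∑[ G ∈ allEdgeSets m ] ∑[ Gs ∈ allTuples m t ] g (G ∷ Gs)
∑-allTuples-suc m t g = trans (∑-concatMap _ (allEdgeSets m) g)
  (∑-cong (allEdgeSets m) (λ G → cong sumℚ (sym (List.map-∘ (allTuples m t)))))

∑-PrTuple : ∀ m t (p : Fin m → ℚ) → ∑ (allTuples m t) (PrTuple p) ≡ 1ℚ
∑-PrTuple m zero    p = refl
∑-PrTuple m (suc t) p = begin
  ∑ (allTuples m (suc t)) (PrTuple p)
    ≡⟨ ∑-allTuples-suc m t (PrTuple p) ⟩
  ∑[ G ∈ allEdgeSets m ] ∑[ Gs ∈ allTuples m t ] (PrSub p G * PrTuple p Gs)
    ≡⟨ ∑-cong (allEdgeSets m) (λ G → ∑-*ˡ (allTuples m t) (PrSub p G) (PrTuple p)) ⟩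
  ∑[ G ∈ allEdgeSets m ] (PrSub p G * ∑ (allTuples m t) (PrTuple p))
    ≡⟨ ∑-cong (allEdgeSets m) (λ G → trans (cong (PrSub p G *_) (∑-PrTuple m t p)) (*-identityʳ _)) ⟩
  ∑ (allEdgeSets m) (PrSub p)
    ≡⟨ ∑-PrSub m p ⟩
  1ℚ
    ∎
  where open ≡-Reasoning

𝔼-allTuples-suc : ∀ m t (p : Fin m → ℚ) (g : Vec (EdgeSet m) (suc t) → ℚ) →
                  𝔼 (allTuples m (suc t)) (PrTuple p) g
                  ≡ 𝔼 (allEdgeSets m) (PrSub p) (λ G → 𝔼 (allTuples m t) (PrTuple p) (g ∘ (G ∷_)))
𝔼-allTuples-suc m t p g = trans (∑-allTuples-suc m t _)
  (∑-cong (allEdgeSets m) (λ G → trans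
    (∑-cong (allTuples m t) (λ Gs → *-assoc (PrSub p G) (PrTuple p Gs) (g (G ∷ Gs))))
    (∑-*ˡ (allTuples m t) (PrSub p G) (λ Gs → PrTuple p Gs * g (G ∷ Gs)))))

ind-∨ : ∀ a b → ind (a ∨ b) ≡ ind a + (1ℚ - ind a) * ind b
ind-∨ true  true  = refl
ind-∨ true  false = refl
ind-∨ false true  = refl
ind-∨ false false = refl

module _ {m : ℕ} (p : Fin m → ℚ) (μ : EdgeSet m → EdgeSet m) (e : Fin m) where

  private
    x = xₑ p μ e
    e∈μ : EdgeSet m → ℚ
    e∈μ G = ind (lookup (μ G) e)

  PrInQ-suc : ∀ t → PrInQ p μ (suc t) e ≡ x + (1ℚ - x) * PrInQ p μ t e
  PrInQ-suc t = begin
    PrInQ p μ (suc t) e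
      ≡⟨ 𝔼-allTuples-suc m t p _ ⟩
    𝔼 Gₛ (PrSub p) (λ G → 𝔼 Gsₛ (PrTuple p) (λ Gs → ind (lookup (μ G) e ∨ inQ μ Gs e)))
      ≡⟨ 𝔼-cong Gₛ (PrSub p) (λ G → 𝔼-cong Gsₛ (PrTuple p) (λ Gs → ind-∨ (lookup (μ G) e) (inQ μ Gs e))) ⟩
    𝔼 Gₛ (PrSub p) (λ G → 𝔼 Gsₛ (PrTuple p) (λ Gs → e∈μ G + (1ℚ - e∈μ G) * ind (inQ μ Gs e)))
      ≡⟨ 𝔼-cong Gₛ (PrSub p) (λ G → 𝔼-affine Gsₛ (PrTuple p) (∑-PrTuple m t p) (e∈μ G) (1ℚ - e∈μ G) _) ⟩
    𝔼 Gₛ (PrSub p) (λ G → e∈μ G + (1ℚ - e∈μ G) * P)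
      ≡⟨ 𝔼-cong Gₛ (PrSub p) (λ G → swap (e∈μ G) P) ⟩
    𝔼 Gₛ (PrSub p) (λ G → P + (1ℚ - P) * e∈μ G)
      ≡⟨ 𝔼-affine Gₛ (PrSub p) (∑-PrSub m p) P (1ℚ - P) e∈μ ⟩
    P + (1ℚ - P) * x
      ≡⟨ swap P x ⟩
    x + (1ℚ - x) * P
      ∎
    where
    open ≡-Reasoning
    Gₛ = allEdgeSets m
    Gsₛ = allTuples m t
    P = PrInQ p μ t e
    swap : ∀ a b → a + (1ℚ - a) * b ≡ b + (1ℚ - b) * a
    swap = solve-∀ ℚ-ring

  PrInQ≡1-[1-xₑ]^t : ∀ t → PrInQ p μ t e ≡ 1ℚ - (1ℚ - x) ^ t
  PrInQ≡1-[1-xₑ]^t zero    = refl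
  PrInQ≡1-[1-xₑ]^t (suc t) = begin
    PrInQ p μ (suc t) e                  ≡⟨ PrInQ-suc t ⟩
    x + (1ℚ - x) * PrInQ p μ t e         ≡⟨ cong (λ P → x + (1ℚ - x) * P) (PrInQ≡1-[1-xₑ]^t t) ⟩
    x + (1ℚ - x) * (1ℚ - (1ℚ - x) ^ t)   ≡⟨ complement x ((1ℚ - x) ^ t) ⟩
    1ℚ - (1ℚ - x) * (1ℚ - x) ^ t         ∎
    where
    open ≡-Reasoning
    complement : ∀ x y → x + (1ℚ - x) * (1ℚ - y) ≡ 1ℚ - (1ℚ - x) * y
    complement = solve-∀ ℚ-ring

claim4p1 : (n m : ℕ) (ends : EdgeMap n m) → Loopless ends →
           (w : Fin m → ℚ) → (∀ e → 0ℚ ≤ w e) →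
           (p : Fin m → ℚ) → (∀ e → (0ℚ < p e) × (p e ≤ 1ℚ)) →
           (μ : EdgeSet m → EdgeSet m) → IsMaxWeightMatchingAlg ends w μ →
           (τ ε : ℚ) → (0ℚ < τ) × (τ < 1ℚ) → (0ℚ < ε) × (ε < 1ℚ) →
           (t : ℕ) → 1ℚ ≤ toℚ t * (τ * ε) →
           (e : Fin m) → τ ≤ xₑ p μ e →
           1ℚ - ε ≤ PrInQ p μ t e
claim4p1 n m ends _ w _ p 0<p≤1 μ _ τ ε _ (0<ε , _) t 1≤tτε e τ≤x = begin
  1ℚ - ε             ≤⟨ +-monoʳ-≤ 1ℚ (neg-antimono-≤ ([1-x]^t≤ε 0≤x x≤1 0≤ε t 1≤txε)) ⟩
  1ℚ - (1ℚ - x) ^ t  ≡⟨ PrInQ≡1-[1-xₑ]^t p μ e t ⟨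
  PrInQ p μ t e      ∎
  where
  open ≤-Reasoning
  x = xₑ p μ e
  0≤ε = <⇒≤ 0<ε
  0≤p≤1 : ∀ i → (0ℚ ≤ p i) × (p i ≤ 1ℚ)
  0≤p≤1 i = <⇒≤ (proj₁ (0<p≤1 i)) , proj₂ (0<p≤1 i)
  0≤x≤1 : (0ℚ ≤ x) × (x ≤ 1ℚ)
  0≤x≤1 = 𝔼-∈[0,1] (allEdgeSets m) (PrSub p) (PrSub-nonNeg p 0≤p≤1) (∑-PrSub m p)
                    (λ G → 0≤ind (lookup (μ G) e)) (λ G → ind≤1 (lookup (μ G) e))
  0≤x = proj₁ 0≤x≤1
  x≤1 = proj₂ 0≤x≤1
  1≤txε : 1ℚ ≤ toℚ t * x * ε
  1≤txε = ≤-trans 1≤tτε (≤-trans (*-monoˡ-≤-0≤ (toℚ-nonNeg t) (*-monoʳ-≤-0≤ 0≤ε τ≤x))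
                                  (≤-reflexive (sym (*-assoc (toℚ t) x ε))))
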